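{- Let $\mathcal{M}=(X,\leq,R,V)$ and $\mathcal{M}'=(X',\leq',R',V')$ be $H$-models whose relations ($\leq,R$ and $\leq',R'$) are image-compact and pre-image-compact, and let $x\in X$, $x'\in X'$. Then $x$ and $x'$ satisfy the same tense bi-intuitionistic formulae if and only if $x$ and $x'$ are $H$-bisimilar.
   Context: Tense bi-intuitionistic formulae are built from propositional variables, $\top,\bot,\wedge,\vee$, intuitionistic implication $\to$, subtraction $\phi\mathbin{ -\!\!<}\psi$, and modalities $\Box$, $\Diamond$, a tense box $\Box^{ - }$ and a tense diamond $\Diamond^{ - }$. For relations $Z,Z'$, $Z\circ Z'=\{(x,y)\mid\exists u.\,xZu,\ uZ'y\}$ and $\breve{Z}$ is the converse. An intuitionistic Kripke model $(X,\leq,V)$ is a preorder with an upset-valued valuation; $x\Vdash\phi\to\psi$ iff every $y\geq x$ satisfying $\phi$ satisfies $\psi$; $x\Vdash\phi\mathbin{ -\!\!<}\psi$ iff some $y\leq x$ satisfies $\phi$ but not $\psi$. An $H$-model is $(X,\leq,R,V)$ with $(X,\leq,V)$ an intuitionistic Kripke model and $R\subseteq X\times X$ satisfying $({\leq}\circ R)\subseteq(R\circ{\leq})$ and $({\leq}\circ R\circ{\leq})=R$. Writing $S=({\geq}\circ R\circ{\geq})$, the semantics is: $x\Vdash\Box\phi$ iff all $y$ with $xRy$ satisfy $\phi$; $x\Vdash\Diamond^{ - }\phi$ iff some $y$ with $yRx$ satisfies $\phi$; $x\Vdash\Diamond\phi$ iff some $y$ with $xSy$ satisfies $\phi$; $x\Vdash\Box^{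 - }\phi$ iff all $y$ with $ySx$ satisfy $\phi$. An $H$-bisimulation is a relation $B\subseteq X\times X'$ such that for all $(x,x')\in B$: $x,x'$ satisfy the same propositional variables; forth/back conditions hold for $\leq$ (if $x\leq y$ there is $y'$ with $x'\leq'y'$ and $yBy'$, and symmetrically) and for $\geq$ (if $y\leq x$ there is $y'\leq'x'$ with $yBy'$, and symmetrically); and for each $Z\in\{R,\breve{R}\}$: if $xZy$ there is $y'$ with $x'Z'y'$ and $yBy'$, and if $x'Z'y'$ there is $y$ with $xZy$ and $yBy'$. $H$-bisimilarity means being linked by some $H$-bisimulation. A relation $Z$ is image-compact (resp. pre-image-compact) if there is a collection $A$ of upsets containing $\emptyset$, $X$ and all $V(p)$, closed under finite unions and intersections, under $a\to b=\{x\mid\forall y\geq x\,(y\in a\Rightarrow y\in b)\}$, under $a\mathbin{ -\!\!<}b=\{x\mid\exists y\leq x\,(y\in a,\ y\notin b)\}$, under $a\mapsto\{x\mid R[x]\subseteq a\}$ and under $a\mapsto\{x\mid\exists y\in a,\ yRx\}$, such that for every $x$ the set $\{y\mid xZy\}$ (resp. $\{y\mid yZx\}$) is compact in the topology generated by the subbase $A\cup\{X\setminus a\mid a\in A\}$. -}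

module Defs where

open import Level using (Level; 0ℓ) renaming (suc to lsuc)
open import Data.Product using (Σ; _×_; _,_; ∃; ∃-syntax)
open import Data.Sum using (_⊎_)
open import Data.Unit using (⊤)
open import Data.Empty using (⊥)
open import Data.Bool using (Bool; true; false)
open import Data.List using (List)
open import Data.List.Relation.Unary.All using (All)
open import Data.List.Relation.Unary.Any using (Any)
open import Relation.Nullary using (¬_)
open import Function.Bundles using (_⇔_)

data Form (Var : Set) : Set where
  var  : Var → Form Var
  ⊤f ⊥f : Form Var
  _∧f_ _∨f_ _⇒f_ _−<_ : Form Var → Form Var → Form Var
  □ ◇ □⁻ ◇⁻ : Form Var → Form Var

Rel : Set → Set → Set₁
Rel X Y = X → Y → Set

_⨾_ : {X Y W : Set} → Rel X Y → Rel Y W → Rel X W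
(Z ⨾ Z') x y = ∃[ u ] (Z x u × Z' u y)

conv : {X Y : Set} → Rel X Y → Rel Y X
conv Z y x = Z x y

_⊆R_ : {X Y : Set} → Rel X Y → Rel X Y → Set
Z ⊆R Z' = ∀ {x y} → Z x y → Z' x y

IsUpset : {X : Set} → Rel X X → (X → Set) → Set
IsUpset _≤_ a = ∀ {x y} → x ≤ y → a x → a y

record HModel (Var : Set) : Set₁ where
  field
    X    : Set
    _≤_  : Rel X X
    R    : Rel X X
    V    : Var → X → Set
    ≤-refl  : ∀ {x} → x ≤ x
    ≤-trans : ∀ {x y z} → x ≤ y → y ≤ z → x ≤ z
    V-up    : ∀ p → IsUpset _≤_ (V p)
    comm    : (_≤_ ⨾ R) ⊆R (R ⨾ _≤_)
    sandw₁  : ((_≤_ ⨾ R) ⨾ _≤_) ⊆R R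
    sandw₂  : R ⊆R ((_≤_ ⨾ R) ⨾ _≤_)

  _≥_ : Rel X X
  x ≥ y = y ≤ x

  S : Rel X X
  S = (_≥_ ⨾ R) ⨾ _≥_

module _ {Var : Set} (M : HModel Var) where
  open HModel M

  Sat : Form Var → X → Set
  Sat (var p)  x = V p x
  Sat ⊤f       x = ⊤
  Sat ⊥f       x = ⊥
  Sat (φ ∧f ψ) x = Sat φ x × Sat ψ x
  Sat (φ ∨f ψ) x = Sat φ x ⊎ Sat ψ x
  Sat (φ ⇒f ψ) x = ∀ y → x ≤ y → Sat φ y → Sat ψ y
  Sat (φ −< ψ) x = ∃[ y ] (y ≤ x × Sat φ y × ¬ Sat ψ y)
  Sat (□ φ)    x = ∀ y → R x y → Sat φ y
  Sat (◇⁻ φ)   x = ∃[ y ] (R y x × Sat φ y)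
  Sat (◇ φ)    x = ∃[ y ] (S x y × Sat φ y)
  Sat (□⁻ φ)   x = ∀ y → S y x → Sat φ y

  ∅ₛ Xₛ : X → Set
  ∅ₛ _ = ⊥
  Xₛ _ = ⊤

  _∪ₛ_ _∩ₛ_ _→ₛ_ _−<ₛ_ : (X → Set) → (X → Set) → X → Set
  (a ∪ₛ b) x = a x ⊎ b x
  (a ∩ₛ b) x = a x × b x
  (a →ₛ b) x = ∀ y → x ≤ y → a y → b y
  (a −<ₛ b) x = ∃[ y ] (y ≤ x × a y × ¬ b y)

  □ₛ ◇⁻ₛ : (X → Set) → X → Set
  □ₛ a x = ∀ y → R x y → a y
  ◇⁻ₛ a x = ∃[ y ] (a y × R y x)

  record Admissible (A : (X → Set) → Set) : Set₁ where
    field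
      upsets : ∀ a → A a → IsUpset _≤_ a
      has-∅  : A ∅ₛ
      has-X  : A Xₛ
      has-V  : ∀ p → A (V p)
      cl-∪   : ∀ {a b} → A a → A b → A (a ∪ₛ b)
      cl-∩   : ∀ {a b} → A a → A b → A (a ∩ₛ b)
      cl-→   : ∀ {a b} → A a → A b → A (a →ₛ b)
      cl-−<  : ∀ {a b} → A a → A b → A (a −<ₛ b)
      cl-□   : ∀ {a} → A a → A (□ₛ a)
      cl-◇⁻  : ∀ {a} → A a → A (◇⁻ₛ a)

  -- The topology generated by the subbase A ∪ {X \ a | a ∈ A}

  module _ (A : (X → Set) → Set) where

    record SubBasic : Set₁ where
      constructor sb
      field
        set : X → Set
        inA : A set
        pos : Bool

    ⟦_⟧ₛ : SubBasic → X → Set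
    ⟦ sb a _ true  ⟧ₛ x = a x
    ⟦ sb a _ false ⟧ₛ x = ¬ a x

    ⟦_⟧ᵇ : List SubBasic → X → Set₁
    ⟦ l ⟧ᵇ x = All (λ s → ⟦ s ⟧ₛ x) l

    IsOpen : (X → Set) → Set₁
    IsOpen U = ∀ x → U x → Σ (List SubBasic) λ l → ⟦ l ⟧ᵇ x × (∀ y → ⟦ l ⟧ᵇ y → U y)

    IsCompact : (X → Set) → Set₂
    IsCompact K = ∀ {I : Set₁} (U : I → X → Set) → (∀ i → IsOpen (U i))
      → (∀ y → K y → ∃[ i ] U i y)
      → Σ (List I) λ is → ∀ y → K y → Any (λ i → U i y) is

  ImageCompact : Rel X X → Set₂
  ImageCompact Z = Σ ((X → Set) → Set) λ A →
    Admissible A × (∀ x → IsCompact A (λ y → Z x y))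

  PreImageCompact : Rel X X → Set₂
  PreImageCompact Z = Σ ((X → Set) → Set) λ A →
    Admissible A × (∀ x → IsCompact A (λ y → Z y x))

module _ {Var : Set} (M M' : HModel Var) where
  private
    module M  = HModel M
    module M' = HModel M'

  ForthBack : (B : Rel M.X M'.X) → Rel M.X M.X → Rel M'.X M'.X → Set
  ForthBack B Z Z' = ∀ {x x'} → B x x' →
    (∀ {y} → Z x y → ∃[ y' ] (Z' x' y' × B y y')) ×
    (∀ {y'} → Z' x' y' → ∃[ y ] (Z x y × B y y'))

  record IsHBisim (B : Rel M.X M'.X) : Set where
    field
      atoms : ∀ {x x'} → B x x' → ∀ p → (M.V p x ⇔ M'.V p x')
      fb-≤  : ForthBack B M._≤_ M'._≤_
      fb-≥  : ForthBack B M._≥_ M'._≥_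
      fb-R  : ForthBack B M.R M'.R
      fb-R˘ : ForthBack B (conv M.R) (conv M'.R)

  HBisimilar : M.X → M'.X → Set₁
  HBisimilar x x' = Σ (Rel M.X M'.X) λ B → IsHBisim B × B x x'

  ModEquiv : M.X → M'.X → Set
  ModEquiv x x' = ∀ φ → (Sat M φ x ⇔ Sat M' φ x')

{-# OPTIONS --safe #-}
-- Bisimulations preserve truth by a routine induction on formulae. Conversely,
-- take for B the equivalence of points on the fragment without ◇ and □⁻: its
-- truth sets lie in every admissible collection A, so they are clopen. If a
-- successor y of x had no B-equivalent counterpart in the compact set K of
-- successors of x', every point of K would violate some literal of y, and a
-- finite subcover gives fragment formulae γ (true at y) and δ (false at y) with
-- γ → δ valid on K. Then γ ⇒ δ, □ (γ ⇒ δ), γ −< δ or ◇⁻ (γ −< δ), according to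
-- the relation, holds at exactly one of x and x', contradicting x B x'.
module Submission where

open import Defs
open import Level using (Level)
open import Axiom.ExcludedMiddle using (ExcludedMiddle)
open import Axiom.DoubleNegationElimination using (em⇒dne)
open import Data.Product using (_×_; _,_; ∃-syntax; proj₁; proj₂)
open import Data.Sum using (inj₁; inj₂)
open import Data.Unit using (tt)
open import Data.Empty using (⊥-elim)
open import Data.Bool using (true; false)
open import Data.List using (List; []; _∷_)
open import Data.List.Relation.Unary.All using ([]; _∷_)
open import Data.List.Relation.Unary.Any using (Any; here; there)
open import Relation.Nullary using (¬_)
open import Function.Bundles using (_⇔_; mk⇔; Equivalence)
open import Function.Construct.Symmetry using (⇔-sym)

open Equivalence using (to; from)

module _ {Var : Set} (M : HModel Var) where
  open HModel M

  R-≤-closed : ∀ {x y z} → R x y → y ≤ z → R x z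
  R-≤-closed {x} r le = sandw₁ (_ , (x , ≤-refl , r) , le)

  ≤-R-closed : ∀ {x y z} → z ≤ y → R y x → R z x
  ≤-R-closed {x} le r = sandw₁ (x , (_ , le , r) , ≤-refl)

  subbasic-open : ∀ {A} (s : SubBasic M A) → IsOpen M A (⟦_⟧ₛ M A s)
  subbasic-open s x u = s ∷ [] , u ∷ [] , λ { y (v ∷ []) → v }

module _ {Var : Set} {M M' : HModel Var} where

  IsHBisim-conv : ∀ {B} → IsHBisim M M' B → IsHBisim M' M (conv B)
  IsHBisim-conv h = record
    { atoms = λ b p → ⇔-sym (atoms b p)
    ; fb-≤  = λ b → proj₂ (fb-≤ b) , proj₁ (fb-≤ b)
    ; fb-≥  = λ b → proj₂ (fb-≥ b) , proj₁ (fb-≥ b)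
    ; fb-R  = λ b → proj₂ (fb-R b) , proj₁ (fb-R b)
    ; fb-R˘ = λ b → proj₂ (fb-R˘ b) , proj₁ (fb-R˘ b)
    }
    where open IsHBisim h

bisim-preserves-Sat : ∀ {Var} {M M' : HModel Var} {B} → IsHBisim M M' B
  → ∀ φ {x x'} → B x x' → Sat M φ x → Sat M' φ x'
bisim-preserves-Sat h (var p) b s = to (IsHBisim.atoms h b p) s
bisim-preserves-Sat h ⊤f b s = tt
bisim-preserves-Sat h (φ ∧f ψ) b (s , t) =
  bisim-preserves-Sat h φ b s , bisim-preserves-Sat h ψ b t
bisim-preserves-Sat h (φ ∨f ψ) b (inj₁ s) = inj₁ (bisim-preserves-Sat h φ b s)
bisim-preserves-Sat h (φ ∨f ψ) b (inj₂ s) = inj₂ (bisim-preserves-Sat h ψ b s)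
bisim-preserves-Sat h (φ ⇒f ψ) b s y' le' t =
  let y , le , b' = proj₂ (IsHBisim.fb-≤ h b) le'
  in bisim-preserves-Sat h ψ b' (s y le (bisim-preserves-Sat (IsHBisim-conv h) φ b' t))
bisim-preserves-Sat h (φ −< ψ) b (y , le , s , ns) =
  let y' , le' , b' = proj₁ (IsHBisim.fb-≥ h b) le
  in y' , le' , bisim-preserves-Sat h φ b' s
     , λ t → ns (bisim-preserves-Sat (IsHBisim-conv h) ψ b' t)
bisim-preserves-Sat h (□ φ) b s y' r' =
  let y , r , b' = proj₂ (IsHBisim.fb-R h b) r'
  in bisim-preserves-Sat h φ b' (s y r)
bisim-preserves-Sat h (◇⁻ φ) b (y , r , s) =
  let y' , r' , b' = proj₁ (IsHBisim.fb-R˘ h b) r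
  in y' , r' , bisim-preserves-Sat h φ b' s
bisim-preserves-Sat h (◇ φ) b (z , (u , (v , v≤x , r) , z≤u) , s) =
  let v' , v'≤x' , b₁ = proj₁ (IsHBisim.fb-≥ h b) v≤x
      u' , r'       , b₂ = proj₁ (IsHBisim.fb-R h b₁) r
      z' , z'≤u'    , b₃ = proj₁ (IsHBisim.fb-≥ h b₂) z≤u
  in z' , (u' , (v' , v'≤x' , r') , z'≤u') , bisim-preserves-Sat h φ b₃ s
bisim-preserves-Sat h (□⁻ φ) b s z' (u' , (v' , z'≤v' , r') , x'≤u') =
  let u , x≤u , b₁ = proj₂ (IsHBisim.fb-≤ h b) x'≤u'
      v , r   , b₂ = proj₂ (IsHBisim.fb-R˘ h b₁) r'
      z , z≤v , b₃ = proj₂ (IsHBisim.fb-≤ h b₂) z'≤v'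
  in bisim-preserves-Sat h φ b₃ (s z (u , (v , z≤v , r) , x≤u))

HBisimilar⇒ModEquiv : ∀ {Var} {M M' : HModel Var} {x x'}
  → HBisimilar M M' x x' → ModEquiv M M' x x'
HBisimilar⇒ModEquiv (B , h , b) φ =
  mk⇔ (bisim-preserves-Sat h φ b) (bisim-preserves-Sat (IsHBisim-conv h) φ b)

data Frag (Var : Set) : Set where
  var : Var → Frag Var
  ⊤f ⊥f : Frag Var
  _∧f_ _∨f_ _⇒f_ _−<_ : Frag Var → Frag Var → Frag Var
  □ ◇⁻ : Frag Var → Frag Var

embed : ∀ {Var} → Frag Var → Form Var
embed (var p) = var p
embed ⊤f = ⊤f
embed ⊥f = ⊥f
embed (φ ∧f ψ) = embed φ ∧f embed ψ
embed (φ ∨f ψ) = embed φ ∨f embed ψ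
embed (φ ⇒f ψ) = embed φ ⇒f embed ψ
embed (φ −< ψ) = embed φ −< embed ψ
embed (□ φ) = □ (embed φ)
embed (◇⁻ φ) = ◇⁻ (embed φ)

module Fragment {Var : Set} (M : HModel Var) where
  open HModel M

  -- Built from the set operations of Defs rather than from Sat: A need not be
  -- closed under extensional equality of sets.
  ⟦_⟧ : Frag Var → X → Set
  ⟦ var p ⟧ = V p
  ⟦ ⊤f ⟧ = Xₛ M
  ⟦ ⊥f ⟧ = ∅ₛ M
  ⟦ φ ∧f ψ ⟧ = _∩ₛ_ M ⟦ φ ⟧ ⟦ ψ ⟧
  ⟦ φ ∨f ψ ⟧ = _∪ₛ_ M ⟦ φ ⟧ ⟦ ψ ⟧
  ⟦ φ ⇒f ψ ⟧ = _→ₛ_ M ⟦ φ ⟧ ⟦ ψ ⟧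
  ⟦ φ −< ψ ⟧ = _−<ₛ_ M ⟦ φ ⟧ ⟦ ψ ⟧
  ⟦ □ φ ⟧ = □ₛ M ⟦ φ ⟧
  ⟦ ◇⁻ φ ⟧ = ◇⁻ₛ M ⟦ φ ⟧

  ⟦⟧-admissible : ∀ {A} → Admissible M A → ∀ φ → A ⟦ φ ⟧
  ⟦⟧-admissible ad (var p) = Admissible.has-V ad p
  ⟦⟧-admissible ad ⊤f = Admissible.has-X ad
  ⟦⟧-admissible ad ⊥f = Admissible.has-∅ ad
  ⟦⟧-admissible ad (φ ∧f ψ) = Admissible.cl-∩ ad (⟦⟧-admissible ad φ) (⟦⟧-admissible ad ψ)
  ⟦⟧-admissible ad (φ ∨f ψ) = Admissible.cl-∪ ad (⟦⟧-admissible ad φ) (⟦⟧-admissible ad ψ)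
  ⟦⟧-admissible ad (φ ⇒f ψ) = Admissible.cl-→ ad (⟦⟧-admissible ad φ) (⟦⟧-admissible ad ψ)
  ⟦⟧-admissible ad (φ −< ψ) = Admissible.cl-−< ad (⟦⟧-admissible ad φ) (⟦⟧-admissible ad ψ)
  ⟦⟧-admissible ad (□ φ) = Admissible.cl-□ ad (⟦⟧-admissible ad φ)
  ⟦⟧-admissible ad (◇⁻ φ) = Admissible.cl-◇⁻ ad (⟦⟧-admissible ad φ)

  ⟦⟧⇒Sat : ∀ φ {x} → ⟦ φ ⟧ x → Sat M (embed φ) x
  Sat⇒⟦⟧ : ∀ φ {x} → Sat M (embed φ) x → ⟦ φ ⟧ x
  ⟦⟧⇒Sat (var p) s = s
  ⟦⟧⇒Sat ⊤f s = s
  ⟦⟧⇒Sat ⊥f s = s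
  ⟦⟧⇒Sat (φ ∧f ψ) (s , t) = ⟦⟧⇒Sat φ s , ⟦⟧⇒Sat ψ t
  ⟦⟧⇒Sat (φ ∨f ψ) (inj₁ s) = inj₁ (⟦⟧⇒Sat φ s)
  ⟦⟧⇒Sat (φ ∨f ψ) (inj₂ t) = inj₂ (⟦⟧⇒Sat ψ t)
  ⟦⟧⇒Sat (φ ⇒f ψ) s y le t = ⟦⟧⇒Sat ψ (s y le (Sat⇒⟦⟧ φ t))
  ⟦⟧⇒Sat (φ −< ψ) (y , le , s , ns) = y , le , ⟦⟧⇒Sat φ s , λ t → ns (Sat⇒⟦⟧ ψ t)
  ⟦⟧⇒Sat (□ φ) s y r = ⟦⟧⇒Sat φ (s y r)
  ⟦⟧⇒Sat (◇⁻ φ) (y , s , r) = y , r , ⟦⟧⇒Sat φ s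
  Sat⇒⟦⟧ (var p) s = s
  Sat⇒⟦⟧ ⊤f s = s
  Sat⇒⟦⟧ ⊥f s = s
  Sat⇒⟦⟧ (φ ∧f ψ) (s , t) = Sat⇒⟦⟧ φ s , Sat⇒⟦⟧ ψ t
  Sat⇒⟦⟧ (φ ∨f ψ) (inj₁ s) = inj₁ (Sat⇒⟦⟧ φ s)
  Sat⇒⟦⟧ (φ ∨f ψ) (inj₂ t) = inj₂ (Sat⇒⟦⟧ ψ t)
  Sat⇒⟦⟧ (φ ⇒f ψ) s y le t = Sat⇒⟦⟧ ψ (s y le (⟦⟧⇒Sat φ t))
  Sat⇒⟦⟧ (φ −< ψ) (y , le , s , ns) = y , le , Sat⇒⟦⟧ φ s , λ t → ns (⟦⟧⇒Sat ψ t)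
  Sat⇒⟦⟧ (□ φ) s y r = Sat⇒⟦⟧ φ (s y r)
  Sat⇒⟦⟧ (◇⁻ φ) (y , r , s) = y , Sat⇒⟦⟧ φ s , r

module _ {Var : Set} (M M' : HModel Var) where
  private
    module M  = HModel M
    module M' = HModel M'
    module F  = Fragment M
    module F' = Fragment M'
  open F using (⟦_⟧)
  open F' using () renaming (⟦_⟧ to ⟦_⟧′)

  FragEquiv : M.X → M'.X → Set
  FragEquiv x x' = ∀ φ → ⟦ φ ⟧ x ⇔ ⟦ φ ⟧′ x'

  Forth : Rel M.X M.X → Rel M'.X M'.X → Set
  Forth Z Z' = ∀ {x x' y} → FragEquiv x x' → Z x y → ∃[ y' ] (Z' x' y' × FragEquiv y y')

  ModEquiv⇒FragEquiv : ∀ {x x'} → ModEquiv M M' x x' → FragEquiv x x'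
  ModEquiv⇒FragEquiv e φ = mk⇔
    (λ s → F'.Sat⇒⟦⟧ φ (to (e (embed φ)) (F.⟦⟧⇒Sat φ s)))
    (λ s → F.Sat⇒⟦⟧ φ (from (e (embed φ)) (F'.⟦⟧⇒Sat φ s)))

FragEquiv-sym : ∀ {Var} {M M' : HModel Var} {x x'}
  → FragEquiv M M' x x' → FragEquiv M' M x' x
FragEquiv-sym e φ = ⇔-sym (e φ)

forth-back : ∀ {Var} {M M' : HModel Var} {Z Z'} → Forth M M' Z Z' → Forth M' M Z' Z
  → ForthBack M M' (FragEquiv M M') Z Z'
forth-back forth back e =
  forth e , λ z' → let y , z , e' = back (FragEquiv-sym e) z' in y , z , FragEquiv-sym e'

module Completeness (lem : ∀ {ℓ} → ExcludedMiddle ℓ) {Var : Set} (M M' : HModel Var) where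
  private
    module M  = HModel M
    module M' = HModel M'
  open Fragment M using (⟦_⟧)
  open Fragment M' using () renaming (⟦_⟧ to ⟦_⟧′; ⟦⟧-admissible to ⟦⟧′-admissible)

  dne : ∀ {ℓ} {P : Set ℓ} → ¬ ¬ P → P
  dne {ℓ} = em⇒dne (lem {ℓ})

  data Literal (y : M.X) : Set₁ where
    true-at  : ∀ φ → ⟦ φ ⟧ y → Literal y
    false-at : ∀ φ → ¬ ⟦ φ ⟧ y → Literal y

  module _ {y : M.X} where

    violation : ∀ {A} → Admissible M' A → Literal y → SubBasic M' A
    violation ad (true-at φ _)  = sb ⟦ φ ⟧′ (⟦⟧′-admissible ad φ) false
    violation ad (false-at φ _) = sb ⟦ φ ⟧′ (⟦⟧′-admissible ad φ) true

    Violates : ∀ {A} → Admissible M' A → Literal y → M'.X → Set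
    Violates ad l z = ⟦_⟧ₛ M' _ (violation ad l) z

    some-literal-violated : ∀ {A} (ad : Admissible M' A) {z}
      → ¬ FragEquiv M M' y z → ∃[ l ] Violates ad l z
    some-literal-violated ad ¬e = dne λ none → ¬e λ φ → mk⇔
      (λ s → dne λ t → none (true-at φ s , t))
      (λ t → dne λ s → none (false-at φ s , t))

    ⋀ ⋁ : List (Literal y) → Frag Var
    ⋀ [] = ⊤f
    ⋀ (true-at φ _ ∷ ls) = φ ∧f ⋀ ls
    ⋀ (false-at _ _ ∷ ls) = ⋀ ls
    ⋁ [] = ⊥f
    ⋁ (true-at _ _ ∷ ls) = ⋁ ls
    ⋁ (false-at φ _ ∷ ls) = φ ∨f ⋁ ls

    ⋀-true : ∀ ls → ⟦ ⋀ ls ⟧ y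
    ⋀-true [] = tt
    ⋀-true (true-at φ s ∷ ls) = s , ⋀-true ls
    ⋀-true (false-at _ _ ∷ ls) = ⋀-true ls

    ⋁-false : ∀ ls → ¬ ⟦ ⋁ ls ⟧ y
    ⋁-false (true-at _ _ ∷ ls) t = ⋁-false ls t
    ⋁-false (false-at φ ns ∷ ls) (inj₁ t) = ns t
    ⋁-false (false-at φ ns ∷ ls) (inj₂ t) = ⋁-false ls t

    violated⇒⋀→⋁ : ∀ {A} (ad : Admissible M' A) ls {z}
      → Any (λ l → Violates ad l z) ls → ⟦ ⋀ ls ⟧′ z → ⟦ ⋁ ls ⟧′ z
    violated⇒⋀→⋁ ad (true-at _ _ ∷ ls) (here ns) (s , _) = ⊥-elim (ns s)
    violated⇒⋀→⋁ ad (false-at _ _ ∷ ls) (here t) _ = inj₁ t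
    violated⇒⋀→⋁ ad (true-at _ _ ∷ ls) (there v) (_ , c) = violated⇒⋀→⋁ ad ls v c
    violated⇒⋀→⋁ ad (false-at _ _ ∷ ls) (there v) c = inj₂ (violated⇒⋀→⋁ ad ls v c)

  realised-in-compact : ∀ {A} (ad : Admissible M' A) {K} → IsCompact M' A K → ∀ {y}
    → (∀ γ δ → ⟦ γ ⟧ y → ¬ ⟦ δ ⟧ y → ¬ (∀ z → K z → ⟦ γ ⟧′ z → ⟦ δ ⟧′ z))
    → ∃[ z ] (K z × FragEquiv M M' y z)
  realised-in-compact ad compact unrefuted = dne λ none →
    let ls , covered = compact (Violates ad) (λ l → subbasic-open M' (violation ad l))
                         (λ z k → some-literal-violated ad λ e → none (z , k , e))
    in unrefuted (⋀ ls) (⋁ ls) (⋀-true ls) (⋁-false ls)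
         (λ z k → violated⇒⋀→⋁ ad ls (covered z k))

  forth-≤ : ImageCompact M' M'._≤_ → Forth M M' M._≤_ M'._≤_
  forth-≤ (A , ad , compact) {x' = x'} {y} e x≤y =
    realised-in-compact ad (compact x') λ γ δ γy ¬δy valid →
      ¬δy (from (e (γ ⇒f δ)) valid y x≤y γy)

  forth-≥ : PreImageCompact M' M'._≤_ → Forth M M' M._≥_ M'._≥_
  forth-≥ (A , ad , compact) {x' = x'} {y} e y≤x =
    realised-in-compact ad (compact x') λ γ δ γy ¬δy valid →
      let z , z≤x' , γz , ¬δz = to (e (γ −< δ)) (y , y≤x , γy , ¬δy)
      in ¬δz (valid z z≤x' γz)

  forth-R : ImageCompact M' M'.R → Forth M M' M.R M'.R
  forth-R (A , ad , compact) {x' = x'} {y} e xRy =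
    realised-in-compact ad (compact x') λ γ δ γy ¬δy valid →
      ¬δy (from (e (□ (γ ⇒f δ))) (λ w x'Rw z w≤z → valid z (R-≤-closed M' x'Rw w≤z))
             y xRy y M.≤-refl γy)

  forth-R˘ : PreImageCompact M' M'.R → Forth M M' (conv M.R) (conv M'.R)
  forth-R˘ (A , ad , compact) {x' = x'} {y} e yRx =
    realised-in-compact ad (compact x') λ γ δ γy ¬δy valid →
      let w , (z , z≤w , γz , ¬δz) , wRx' =
            to (e (◇⁻ (γ −< δ))) (y , (y , M.≤-refl , γy , ¬δy) , yRx)
      in ¬δz (valid z (≤-R-closed M' z≤w wRx') γz)

record CompactRelations {Var : Set} (M : HModel Var) : Set₂ where
  open HModel M
  field
    ≤-image    : ImageCompact M _≤_
    ≤-preimage : PreImageCompact M _≤_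
    R-image    : ImageCompact M R
    R-preimage : PreImageCompact M R

FragEquiv-isHBisim : (lem : ∀ {ℓ} → ExcludedMiddle ℓ) → ∀ {Var} {M M' : HModel Var}
  → CompactRelations M → CompactRelations M' → IsHBisim M M' (FragEquiv M M')
FragEquiv-isHBisim lem {M = M} {M'} c c' = record
  { atoms = λ e p → e (var p)
  ; fb-≤  = forth-back (C.forth-≤ (≤-image c'))    (C˘.forth-≤ (≤-image c))
  ; fb-≥  = forth-back (C.forth-≥ (≤-preimage c')) (C˘.forth-≥ (≤-preimage c))
  ; fb-R  = forth-back (C.forth-R (R-image c'))    (C˘.forth-R (R-image c))
  ; fb-R˘ = forth-back (C.forth-R˘ (R-preimage c')) (C˘.forth-R˘ (R-preimage c))
  }
  where
  open CompactRelations
  module C  = Completeness lem M M'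
  module C˘ = Completeness lem M' M

corollary6p16 : (lem : ∀ {ℓ : Level} → ExcludedMiddle ℓ)
    → {Var : Set} (M M' : HModel Var)
    → ImageCompact M (HModel._≤_ M) → PreImageCompact M (HModel._≤_ M)
    → ImageCompact M (HModel.R M) → PreImageCompact M (HModel.R M)
    → ImageCompact M' (HModel._≤_ M') → PreImageCompact M' (HModel._≤_ M')
    → ImageCompact M' (HModel.R M') → PreImageCompact M' (HModel.R M')
    → (x : HModel.X M) (x' : HModel.X M')
    → ModEquiv M M' x x' ⇔ HBisimilar M M' x x'
corollary6p16 lem M M' i≤ p≤ iR pR i≤' p≤' iR' pR' x x' =
  mk⇔ (λ e → FragEquiv M M' , FragEquiv-isHBisim lem c c' , ModEquiv⇒FragEquiv M M' e)
      HBisimilar⇒ModEquiv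
  where
  c : CompactRelations M
  c = record { ≤-image = i≤ ; ≤-preimage = p≤ ; R-image = iR ; R-preimage = pR }
  c' : CompactRelations M'
  c' = record { ≤-image = i≤' ; ≤-preimage = p≤' ; R-image = iR' ; R-preimage = pR' }
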